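{- Let $0<q<1$ and let $B^{(r)}_{n,q}(x)$, $B^{(r)}_{n,q}$ and $E^{(r)}_{k,q}(x)$ be as defined in the context. Then for all integers $n,r \geq 0$, $$B_{n,q}^{(r)}(x)=\frac{1}{2^r}\sum_{k=0}^{n} \Bigg\{ \sum_{m=0}^{n-k}\sum_{l=0}^{r} \sum_{\substack{i_1+ \cdots +i_l=m\\ i_1,\dots,i_l\ge0}}\binom{r}{l}\binom{m}{i_1, \cdots , i_l}_q \binom{m+k}{m}_q \binom{n}{m+k}_q B_{n-m-k,q}^{(r)} \Bigg\} E_{k,q}^{(r)}(x),$$ where $\binom{m}{i_1, \cdots , i_l}_q=\frac{[m]_q!}{[i_1]_q!\cdots[i_l]_q!}$.
   Context: Fix a real number $q$ with $0<q<1$. For an integer $n\ge 0$ set $[n]_q=\frac{1-q^n}{1-q}$, $[0]_q!=1$, $[n]_q!=[1]_q\cdots[n]_q$, and $\binom{n}{k}_q=\frac{[n]_q!}{[k]_q![n-k]_q!}$ for $0\le k\le n$. Let $e_q(z)=\sum_{n=0}^{\infty}\frac{z^n}{[n]_q!}$. For an integer $r\ge0$, the $q$-Euler polynomials of order $r$ are defined by the formal power series identity $\left(\frac{2}{e_q(t)+1}\right)^r e_q(xt)=\sum_{n\ge0}E^{(r)}_{n,q}(x)\frac{t^n}{[n]_q!}$, and the $q$-Bernoulli polynomials of order $r$ by $\left(\frac{t}{e_q(t)-1}\right)^r e_q(xt)=\sum_{n\ge0}B^{(r)}_{n,q}(x)\frac{t^n}{[n]_q!}$, with $B^{(r)}_{n,q}=B^{(r)}_{n,q}(0)$.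 For $l=0$ the sum over $i_1+\cdots+i_0=m$ is understood as $1$ if $m=0$ and $0$ otherwise. -}

module Defs where

open import Level using (Level)
open import Algebra.Bundles using (CommutativeRing)
open import Data.Nat using (ℕ; zero; suc; _∸_) renaming (_+_ to _+ℕ_)
open import Data.Nat.Combinatorics using (_C_)
open import Data.List using (List; []; _∷_; map; concat)
open import Data.Vec using (Vec; []; _∷_)

-- q-calculus and q-Euler / q-Bernoulli polynomials of order r over a
-- commutative ring R, given q, a chosen inverse  inv n  of [n+1]_q for
-- every n, and a chosen inverse  half  of 2.  (For R = ℝ, 0<q<1 these
-- inverses exist.)
module QCalc {c ℓ : Level} (R : CommutativeRing c ℓ)
             (q : CommutativeRing.Carrier R)
             (inv : ℕ → CommutativeRing.Carrier R)
             (half : CommutativeRing.Carrier R) where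

  open CommutativeRing R hiding (zero)

  natR : ℕ → Carrier
  natR zero = 0#
  natR (suc n) = 1# + natR n

  _^R_ : Carrier → ℕ → Carrier
  a ^R zero = 1#
  a ^R suc n = (a ^R n) * a

  sum< : ℕ → (ℕ → Carrier) → Carrier
  sum< zero f = 0#
  sum< (suc n) f = sum< n f + f n

  sum≤ : ℕ → (ℕ → Carrier) → Carrier
  sum≤ n f = sum< (suc n) f

  sumList : List Carrier → Carrier
  sumList [] = 0#
  sumList (a ∷ as) = a + sumList as

  -- [n]_q = 1 + q + ... + q^{n-1}  ( = (1-q^n)/(1-q) )
  qint : ℕ → Carrier
  qint n = sum< n (λ i → q ^R i)

  qfact : ℕ → Carrier
  qfact zero = 1#
  qfact (suc n) = qfact n * qint (suc n)

  -- 1/[n]_q!   (inv k is the inverse of [k+1]_q)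
  qfactInv : ℕ → Carrier
  qfactInv zero = 1#
  qfactInv (suc n) = qfactInv n * inv n

  qbinom : ℕ → ℕ → Carrier
  qbinom n k = qfact n * (qfactInv k * qfactInv (n ∸ k))

  prodInvFact : ∀ {l} → Vec ℕ l → Carrier
  prodInvFact [] = 1#
  prodInvFact (i ∷ is) = qfactInv i * prodInvFact is

  qmultinom : ∀ {l} → ℕ → Vec ℕ l → Carrier
  qmultinom m is = qfact m * prodInvFact is

  upto : ℕ → List ℕ
  upto zero = zero ∷ []
  upto (suc n) = suc n ∷ upto n

  compositions : (l m : ℕ) → List (Vec ℕ l)
  compositions zero zero = [] ∷ []
  compositions zero (suc m) = []
  compositions (suc l) m =
    concat (map (λ i → map (i ∷_) (compositions l (m ∸ i))) (upto m))

  sumComp : (l m : ℕ) → (Vec ℕ l → Carrier) → Carrier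
  sumComp l m f = sumList (map f (compositions l m))

  -- formal power series in t: coefficient sequences
  Series : Set c
  Series = ℕ → Carrier

  _⊛_ : Series → Series → Series
  (f ⊛ g) n = sum≤ n (λ k → f k * g (n ∸ k))

  one : Series
  one zero = 1#
  one (suc n) = 0#

  powS : ℕ → Series → Series
  powS zero f = one
  powS (suc r) f = powS r f ⊛ f

  scale : Carrier → Series → Series
  scale a f n = a * f n

  -- multiplicative inverse of a series f whose constant term has inverse c0:
  -- g 0 = c0,  g n = - c0 * Σ_{k=1}^{n} f k * g (n-k).
  -- invList f c0 n = [g n, g (n-1), ..., g 0]
  private
    dot : ℕ → Series → List Carrier → Carrier
    dot j f [] = 0#
    dot j f (a ∷ as) = f (suc j) * a + dot (suc j) f as

  invList : Series → Carrier → ℕ → List Carrier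
  invList f c0 zero = c0 ∷ []
  invList f c0 (suc n) =
    (- (c0 * dot 0 f (invList f c0 n))) ∷ invList f c0 n

  invS : Series → Carrier → Series
  invS f c0 n with invList f c0 n
  ... | a ∷ _ = a
  ... | [] = 0#

  eqS : Series
  eqS n = qfactInv n

  eqxS : Carrier → Series
  eqxS x n = (x ^R n) * qfactInv n

  eqPlus1 : Series
  eqPlus1 zero = 1# + 1#
  eqPlus1 (suc n) = qfactInv (suc n)

  eulerGen : Series
  eulerGen = scale (1# + 1#) (invS eqPlus1 half)

  -- (e_q(t)-1)/t  (constant term 1)
  eqMinus1DivT : Series
  eqMinus1DivT n = qfactInv (suc n)

  bernGen : Series
  bernGen = invS eqMinus1DivT 1#

  E : ℕ → ℕ → Carrier → Carrier
  E r n x = qfact n * ((powS r eulerGen ⊛ eqxS x) n)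

  B : ℕ → ℕ → Carrier → Carrier
  B r n x = qfact n * ((powS r bernGen ⊛ eqxS x) n)

  B0 : ℕ → ℕ → Carrier
  B0 r n = B r n 0#

  binomR : ℕ → ℕ → Carrier
  binomR r l = natR (r C l)

{-# OPTIONS --safe #-}
module Submission where

-- Write P = (e_q(t) + 1)^r and β = (t / (e_q(t) - 1))^r.  Since (2 / (e_q(t) + 1))^r · P = 2^r,
--   β · e_q(xt) = 2^(-r) · [(2 / (e_q(t) + 1))^r e_q(xt)] · [P β],
-- and comparing coefficients of t^n gives the theorem once [t^m] P is expanded: by the
-- binomial theorem P = Σ_l (r choose l) e_q(t)^l, and [t^m] e_q(t)^l is the sum over the
-- compositions i_1 + ... + i_l = m of 1 / ([i_1]_q! ... [i_l]_q!).  The q-factorials of the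
-- q-binomial coefficients then telescope:  [m]_q! (m+k choose m)_q (n choose m+k)_q [n-m-k]_q!
-- = [n]_q! / [k]_q!.

open import Defs
open import Level using (Level)
open import Algebra.Bundles using (CommutativeRing; CommutativeMonoid)
open import Data.Nat using (ℕ; zero; suc; _∸_; _≤_; _<_; s≤s⁻¹) renaming (_+_ to _+ℕ_)
import Data.Nat.Properties as ℕ
open import Data.Nat.Combinatorics using (_C_; nCk+nC[k+1]≡[n+1]C[k+1]; k>n⇒nCk≡0)
open import Data.List using (List; []; _∷_; map; concat; _++_)
import Data.List.Properties as List
open import Data.Vec using (Vec; _∷_)
open import Data.Product using (_,_)
open import Function using (_∘_)
open import Relation.Binary.PropositionalEquality as ≡ using (_≡_)
import Algebra.Properties.CommutativeSemigroup as CommutativeSemigroupProperties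
import Algebra.Solver.CommutativeMonoid as CommutativeMonoidSolver
import Relation.Binary.Reasoning.Setoid as SetoidReasoning

module QSeries {c ℓ : Level} (R : CommutativeRing c ℓ)
               (q : CommutativeRing.Carrier R)
               (inv : ℕ → CommutativeRing.Carrier R)
               (half : CommutativeRing.Carrier R) where

  open CommutativeRing R hiding (zero)
  open QCalc R q inv half
  open SetoidReasoning setoid
  open import Algebra.Properties.Ring ring using (-‿distribʳ-*)
  module +-Solver = CommutativeMonoidSolver +-commutativeMonoid
  module *-Solver = CommutativeMonoidSolver *-commutativeMonoid
  open CommutativeSemigroupProperties *-commutativeSemigroup using () renaming (interchange to *-interchange)

  sum<-cong-< : ∀ n {f g : ℕ → Carrier} → (∀ i → i < n → f i ≈ g i) → sum< n f ≈ sum< n g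
  sum<-cong-< zero f≈g = refl
  sum<-cong-< (suc n) f≈g =
    +-cong (sum<-cong-< n (λ i i<n → f≈g i (ℕ.m<n⇒m<1+n i<n))) (f≈g n (ℕ.n<1+n n))

  sum<-cong : ∀ n {f g : ℕ → Carrier} → (∀ i → f i ≈ g i) → sum< n f ≈ sum< n g
  sum<-cong n f≈g = sum<-cong-< n (λ i _ → f≈g i)

  sum<-0 : ∀ n → sum< n (λ _ → 0#) ≈ 0#
  sum<-0 zero = refl
  sum<-0 (suc n) = trans (+-identityʳ _) (sum<-0 n)

  sum<-+ : ∀ n (f g : ℕ → Carrier) → sum< n (λ i → f i + g i) ≈ sum< n f + sum< n g
  sum<-+ zero f g = sym (+-identityˡ 0#)
  sum<-+ (suc n) f g = trans (+-cong (sum<-+ n f g) refl) (middle-swap _ _ _ _)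
    where
    open +-Solver
    middle-swap : ∀ a b a′ b′ → (a + b) + (a′ + b′) ≈ (a + a′) + (b + b′)
    middle-swap = solve 4 (λ a b a′ b′ → (a ⊕ b) ⊕ (a′ ⊕ b′) ⊜ (a ⊕ a′) ⊕ (b ⊕ b′)) refl

  *-distribˡ-sum< : ∀ n a (f : ℕ → Carrier) → a * sum< n f ≈ sum< n (λ i → a * f i)
  *-distribˡ-sum< zero a f = zeroʳ a
  *-distribˡ-sum< (suc n) a f = trans (distribˡ a _ _) (+-cong (*-distribˡ-sum< n a f) refl)

  *-distribʳ-sum< : ∀ n a (f : ℕ → Carrier) → sum< n f * a ≈ sum< n (λ i → f i * a)
  *-distribʳ-sum< zero a f = zeroˡ a
  *-distribʳ-sum< (suc n) a f = trans (distribʳ a _ _) (+-cong (*-distribʳ-sum< n a f) refl)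

  sum<-suc-first : ∀ n (f : ℕ → Carrier) → sum< (suc n) f ≈ f 0 + sum< n (f ∘ suc)
  sum<-suc-first zero f = trans (+-identityˡ _) (sym (+-identityʳ _))
  sum<-suc-first (suc n) f = trans (+-cong (sum<-suc-first n f) refl) (+-assoc _ _ _)

  sum<-swap : ∀ n m (F : ℕ → ℕ → Carrier) →
    sum< n (λ i → sum< m (F i)) ≈ sum< m (λ j → sum< n (λ i → F i j))
  sum<-swap zero m F = sym (sum<-0 m)
  sum<-swap (suc n) m F = trans (+-cong (sum<-swap n m F) refl) (sym (sum<-+ m _ _))

  sum<-reverse : ∀ n (f : ℕ → Carrier) → sum< n f ≈ sum< n (λ i → f (n ∸ suc i))
  sum<-reverse zero f = refl
  sum<-reverse (suc n) f = trans (+-cong (sum<-reverse n f) refl)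
    (trans (+-comm _ _) (sym (sum<-suc-first n (λ i → f (n ∸ i)))))

  sum≤-triangle : ∀ n (F : ℕ → ℕ → Carrier) →
    sum≤ n (λ k → sum≤ k (λ j → F j k)) ≈ sum≤ n (λ j → sum≤ (n ∸ j) (λ i → F j (j +ℕ i)))
  sum≤-triangle zero F = refl
  sum≤-triangle (suc n) F = begin
      sum≤ n (λ k → sum≤ k (λ j → F j k)) + (sum≤ n (λ j → F j (suc n)) + F (suc n) (suc n))
        ≈⟨ +-cong (sum≤-triangle n F) refl ⟩
      sum≤ n row + (sum≤ n (λ j → F j (suc n)) + F (suc n) (suc n))
        ≈⟨ +-assoc _ _ _ ⟨
      (sum≤ n row + sum≤ n (λ j → F j (suc n))) + F (suc n) (suc n)
        ≈⟨ +-cong (sum<-+ (suc n) row (λ j → F j (suc n))) last-row ⟨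
      sum≤ n (λ j → row j + F j (suc n)) + row′ (suc n)
        ≈⟨ +-cong (sum<-cong-< (suc n) (λ j j<1+n → sym (row′-extends j (s≤s⁻¹ j<1+n)))) refl ⟩
      sum≤ n row′ + row′ (suc n) ∎
    where
    row row′ : ℕ → Carrier
    row j = sum≤ (n ∸ j) (λ i → F j (j +ℕ i))
    row′ j = sum≤ (suc n ∸ j) (λ i → F j (j +ℕ i))
    row′-extends : ∀ j → j ≤ n → row′ j ≈ row j + F j (suc n)
    row′-extends j j≤n =
      trans (reflexive (≡.cong (λ m → sum< m (λ i → F j (j +ℕ i))) (≡.cong suc (ℕ.+-∸-assoc 1 j≤n))))
            (+-cong refl (reflexive (≡.cong (F j) (≡.trans (ℕ.+-suc j (n ∸ j)) (≡.cong suc (ℕ.m+[n∸m]≡n j≤n))))))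
    last-row : row′ (suc n) ≈ F (suc n) (suc n)
    last-row =
      trans (reflexive (≡.cong (λ m → sum< (suc m) (λ i → F (suc n) (suc n +ℕ i))) (ℕ.n∸n≡0 n)))
            (trans (+-identityˡ _) (reflexive (≡.cong (F (suc n)) (ℕ.+-identityʳ (suc n)))))

  infix 4 _≐_
  record _≐_ (f g : Series) : Set ℓ where
    constructor coeffwise
    field coeff : ∀ n → f n ≈ g n
  open _≐_

  ⊛-cong : ∀ {f f′ g g′} → f ≐ f′ → g ≐ g′ → f ⊛ g ≐ f′ ⊛ g′
  ⊛-cong f≐f′ g≐g′ = coeffwise λ n → sum<-cong (suc n) (λ k → *-cong (coeff f≐f′ k) (coeff g≐g′ (n ∸ k)))

  ⊛-identityˡ : ∀ f → one ⊛ f ≐ f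
  ⊛-identityˡ f = coeffwise λ n → trans (sum<-suc-first n _)
    (trans (+-cong (*-identityˡ (f n)) (trans (sum<-cong n (λ i → zeroˡ _)) (sum<-0 n))) (+-identityʳ _))

  ⊛-comm : ∀ f g → f ⊛ g ≐ g ⊛ f
  ⊛-comm f g = coeffwise λ n → trans (sum<-reverse (suc n) _) (sum<-cong-< (suc n) λ i i<1+n →
    trans (*-comm _ _) (reflexive (≡.cong (λ j → g j * f (n ∸ i)) (ℕ.m∸[m∸n]≡n (s≤s⁻¹ i<1+n)))))

  ⊛-identityʳ : ∀ f → f ⊛ one ≐ f
  ⊛-identityʳ f = coeffwise λ n → trans (coeff (⊛-comm f one) n) (coeff (⊛-identityˡ f) n)

  ⊛-assoc : ∀ f g h → (f ⊛ g) ⊛ h ≐ f ⊛ (g ⊛ h)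
  ⊛-assoc f g h = coeffwise λ n → begin
    sum≤ n (λ k → sum≤ k (λ j → f j * g (k ∸ j)) * h (n ∸ k))
      ≈⟨ sum<-cong (suc n) (λ k → *-distribʳ-sum< (suc k) _ _) ⟩
    sum≤ n (λ k → sum≤ k (λ j → f j * g (k ∸ j) * h (n ∸ k)))
      ≈⟨ sum≤-triangle n (λ j k → f j * g (k ∸ j) * h (n ∸ k)) ⟩
    sum≤ n (λ j → sum≤ (n ∸ j) (λ i → f j * g (j +ℕ i ∸ j) * h (n ∸ (j +ℕ i))))
      ≈⟨ sum<-cong (suc n) (λ j → sum<-cong (suc (n ∸ j)) (λ i → trans (*-assoc _ _ _)
           (*-cong refl (reflexive (≡.cong₂ (λ a b → g a * h b) (ℕ.m+n∸m≡n j i) (≡.sym (ℕ.∸-+-assoc n j i))))))) ⟩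
    sum≤ n (λ j → sum≤ (n ∸ j) (λ i → f j * (g i * h (n ∸ j ∸ i))))
      ≈⟨ sum<-cong (suc n) (λ j → *-distribˡ-sum< (suc (n ∸ j)) _ _) ⟨
    (f ⊛ (g ⊛ h)) n ∎

  ⊛-commutativeMonoid : CommutativeMonoid c ℓ
  ⊛-commutativeMonoid = record
    { Carrier = Series
    ; _≈_ = _≐_
    ; _∙_ = _⊛_
    ; ε = one
    ; isCommutativeMonoid = record
      { isMonoid = record
        { isSemigroup = record
          { isMagma = record
            { isEquivalence = record
              { refl = coeffwise λ n → refl
              ; sym = λ f≐g → coeffwise λ n → sym (coeff f≐g n)
              ; trans = λ f≐g g≐h → coeffwise λ n → trans (coeff f≐g n) (coeff g≐h n)
              }
            ; ∙-cong = ⊛-cong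
            }
          ; assoc = ⊛-assoc
          }
        ; identity = ⊛-identityˡ , ⊛-identityʳ
        }
      ; comm = ⊛-comm
      }
    }

  module Series = CommutativeMonoid ⊛-commutativeMonoid
  open CommutativeSemigroupProperties Series.commutativeSemigroup using (interchange)

  ⊛-scaleˡ : ∀ a f g → scale a f ⊛ g ≐ scale a (f ⊛ g)
  ⊛-scaleˡ a f g = coeffwise λ n →
    trans (sum<-cong (suc n) (λ k → *-assoc _ _ _)) (sym (*-distribˡ-sum< (suc n) a _))

  powS-cong : ∀ r {f g} → f ≐ g → powS r f ≐ powS r g
  powS-cong zero f≐g = Series.refl
  powS-cong (suc r) f≐g = ⊛-cong (powS-cong r f≐g) f≐g

  powS-distrib-⊛ : ∀ r f g → powS r f ⊛ powS r g ≐ powS r (f ⊛ g)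
  powS-distrib-⊛ zero f g = ⊛-identityˡ one
  powS-distrib-⊛ (suc r) f g =
    Series.trans (interchange (powS r f) f (powS r g) g) (⊛-cong (powS-distrib-⊛ r f g) (Series.refl {f ⊛ g}))

  powS-scale-one : ∀ r a → powS r (scale a one) ≐ scale (a ^R r) one
  powS-scale-one zero a = coeffwise λ n → sym (*-identityˡ _)
  powS-scale-one (suc r) a =
    Series.trans (⊛-cong (powS-scale-one r a) (Series.refl {scale a one}))
      (Series.trans (⊛-scaleˡ (a ^R r) one (scale a one)) (coeffwise λ n →
        trans (*-cong refl (coeff (⊛-identityˡ (scale a one)) n)) (sym (*-assoc _ _ _))))

  -- Defs keeps the helper of invList private; abstracting the literal index 0 turns the
  -- unification problem for the meta below into a pattern, which recovers that helper.
  mutual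
    dot : ℕ → Series → List Carrier → Carrier
    dot = _

    invS-suc-dot : ∀ f c₀ n → invS f c₀ (suc n) ≡ - (c₀ * dot 0 f (invList f c₀ n))
    invS-suc-dot f c₀ n with invList f c₀ n | 0
    ... | _ | _ = ≡.refl

  dot-invList : ∀ f c₀ m j →
    dot j f (invList f c₀ m) ≈ sum< (suc m) (λ k → f (suc (j +ℕ k)) * invS f c₀ (m ∸ k))
  dot-invList f c₀ zero j = begin
      f (suc j) * c₀ + 0#           ≈⟨ +-comm _ _ ⟩
      0# + f (suc j) * c₀           ≈⟨ +-cong refl (*-cong (reflexive (≡.cong (f ∘ suc) (≡.sym (ℕ.+-identityʳ j)))) refl) ⟩
      0# + f (suc (j +ℕ 0)) * c₀    ∎
  dot-invList f c₀ (suc m) j = begin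
      f (suc j) * invS f c₀ (suc m) + dot (suc j) f (invList f c₀ m)
        ≈⟨ +-cong (*-cong (reflexive (≡.cong (f ∘ suc) (≡.sym (ℕ.+-identityʳ j)))) refl) (dot-invList f c₀ m (suc j)) ⟩
      f (suc (j +ℕ 0)) * invS f c₀ (suc m) + sum< (suc m) (λ k → f (suc (suc j +ℕ k)) * invS f c₀ (m ∸ k))
        ≈⟨ +-cong refl (sum<-cong (suc m) (λ k → *-cong (reflexive (≡.cong (f ∘ suc) (≡.sym (ℕ.+-suc j k)))) refl)) ⟩
      f (suc (j +ℕ 0)) * invS f c₀ (suc m) + sum< (suc m) (λ k → f (suc (j +ℕ suc k)) * invS f c₀ (m ∸ k))
        ≈⟨ sum<-suc-first (suc m) (λ k → f (suc (j +ℕ k)) * invS f c₀ (suc m ∸ k)) ⟨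
      sum< (suc (suc m)) (λ k → f (suc (j +ℕ k)) * invS f c₀ (suc m ∸ k)) ∎

  invS-suc : ∀ f c₀ n → invS f c₀ (suc n) ≈ - (c₀ * sum< (suc n) (λ k → f (suc k) * invS f c₀ (n ∸ k)))
  invS-suc f c₀ n = trans (reflexive (invS-suc-dot f c₀ n)) (-‿cong (*-cong refl (dot-invList f c₀ n 0)))

  invS-inverseʳ : ∀ f c₀ → c₀ * f 0 ≈ 1# → f ⊛ invS f c₀ ≐ one
  invS-inverseʳ f c₀ c₀f₀≈1 = coeffwise coefficient
    where
    coefficient : ∀ n → (f ⊛ invS f c₀) n ≈ one n
    coefficient zero = trans (+-identityˡ _) (trans (*-comm _ _) c₀f₀≈1)
    coefficient (suc m) = begin
      (f ⊛ invS f c₀) (suc m)     ≈⟨ sum<-suc-first (suc m) _ ⟩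
      f 0 * invS f c₀ (suc m) + S  ≈⟨ +-cong (*-cong refl (invS-suc f c₀ m)) refl ⟩
      f 0 * - (c₀ * S) + S         ≈⟨ +-cong (sym (-‿distribʳ-* _ _)) refl ⟩
      - (f 0 * (c₀ * S)) + S       ≈⟨ +-cong (-‿cong f₀c₀S≈S) refl ⟩
      - S + S                      ≈⟨ -‿inverseˡ S ⟩
      0#                           ∎
      where
      S : Carrier
      S = sum< (suc m) (λ k → f (suc k) * invS f c₀ (m ∸ k))
      f₀c₀S≈S : f 0 * (c₀ * S) ≈ S
      f₀c₀S≈S = trans (sym (*-assoc _ _ _)) (trans (*-cong (trans (*-comm _ _) c₀f₀≈1) refl) (*-identityˡ S))

  natR-+ : ∀ a b → natR (a +ℕ b) ≈ natR a + natR b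
  natR-+ zero b = sym (+-identityˡ _)
  natR-+ (suc a) b = trans (+-cong refl (natR-+ a b)) (sym (+-assoc _ _ _))

  binomR-pascal : ∀ r l → binomR (suc r) (suc l) ≈ binomR r l + binomR r (suc l)
  binomR-pascal r l =
    trans (reflexive (≡.cong natR (≡.sym (nCk+nC[k+1]≡[n+1]C[k+1] r l)))) (natR-+ (r C l) (r C suc l))

  sum≤-binomR-suc : ∀ r (a : ℕ → Carrier) →
    sum≤ (suc r) (λ l → binomR (suc r) l * a l) ≈
    sum≤ r (λ l → binomR r l * a l) + sum≤ r (λ l → binomR r l * a (suc l))
  sum≤-binomR-suc r a = begin
      sum≤ (suc r) (λ l → binomR (suc r) l * a l)
        ≈⟨ sum<-suc-first (suc r) _ ⟩
      binomR r 0 * a 0 + sum≤ r (λ l → binomR (suc r) (suc l) * a (suc l))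
        ≈⟨ +-cong refl (sum<-cong (suc r) (λ l → trans (*-cong (binomR-pascal r l) refl) (distribʳ _ _ _))) ⟩
      binomR r 0 * a 0 + sum≤ r (λ l → binomR r l * a (suc l) + binomR r (suc l) * a (suc l))
        ≈⟨ +-cong refl (sum<-+ (suc r) _ _) ⟩
      binomR r 0 * a 0 + (shifted + sum≤ r (λ l → binomR r (suc l) * a (suc l)))
        ≈⟨ +-cong refl (+-cong refl (trans (+-cong refl last-term-vanishes) (+-identityʳ _))) ⟩
      binomR r 0 * a 0 + (shifted + sum< r (λ l → binomR r (suc l) * a (suc l)))
        ≈⟨ regroup _ _ _ ⟩
      (binomR r 0 * a 0 + sum< r (λ l → binomR r (suc l) * a (suc l))) + shifted
        ≈⟨ +-cong (sum<-suc-first r (λ l → binomR r l * a l)) refl ⟨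
      sum≤ r (λ l → binomR r l * a l) + shifted ∎
    where
    shifted : Carrier
    shifted = sum≤ r (λ l → binomR r l * a (suc l))
    last-term-vanishes : binomR r (suc r) * a (suc r) ≈ 0#
    last-term-vanishes = trans (*-cong (reflexive (≡.cong natR (k>n⇒nCk≡0 (ℕ.n<1+n r)))) refl) (zeroˡ _)
    open +-Solver
    regroup : ∀ x y z → x + (y + z) ≈ (x + z) + y
    regroup = solve 3 (λ x y z → x ⊕ (y ⊕ z) ⊜ (x ⊕ z) ⊕ y) refl

  infixl 6 _⊞_
  _⊞_ : Series → Series → Series
  (f ⊞ g) n = f n + g n

  binomialSum : ℕ → Series → Series
  binomialSum r g n = sum≤ r (λ l → binomR r l * powS l g n)

  binomialSum-⊛ : ∀ r g h n → (binomialSum r g ⊛ h) n ≈ sum≤ r (λ l → binomR r l * (powS l g ⊛ h) n)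
  binomialSum-⊛ r g h n = begin
      sum≤ n (λ k → sum≤ r (λ l → binomR r l * powS l g k) * h (n ∸ k))
        ≈⟨ sum<-cong (suc n) (λ k → *-distribʳ-sum< (suc r) _ _) ⟩
      sum≤ n (λ k → sum≤ r (λ l → binomR r l * powS l g k * h (n ∸ k)))
        ≈⟨ sum<-swap (suc n) (suc r) _ ⟩
      sum≤ r (λ l → sum≤ n (λ k → binomR r l * powS l g k * h (n ∸ k)))
        ≈⟨ sum<-cong (suc r) (λ l → trans (sum<-cong (suc n) (λ k → *-assoc _ _ _)) (sym (*-distribˡ-sum< (suc n) _ _))) ⟩
      sum≤ r (λ l → binomR r l * (powS l g ⊛ h) n) ∎

  binomial-theorem : ∀ r g → powS r (one ⊞ g) ≐ binomialSum r g
  binomial-theorem zero g = coeffwise λ n →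
    sym (trans (+-identityˡ _) (trans (*-cong (+-identityʳ 1#) refl) (*-identityˡ _)))
  binomial-theorem (suc r) g = coeffwise λ n → begin
      (powS r (one ⊞ g) ⊛ (one ⊞ g)) n
        ≈⟨ coeff (⊛-cong (binomial-theorem r g) (Series.refl {one ⊞ g})) n ⟩
      (binomialSum r g ⊛ (one ⊞ g)) n
        ≈⟨ sum<-cong (suc n) (λ k → distribˡ _ _ _) ⟩
      sum≤ n (λ k → binomialSum r g k * one (n ∸ k) + binomialSum r g k * g (n ∸ k))
        ≈⟨ sum<-+ (suc n) _ _ ⟩
      (binomialSum r g ⊛ one) n + (binomialSum r g ⊛ g) n
        ≈⟨ +-cong (coeff (⊛-identityʳ (binomialSum r g)) n) (binomialSum-⊛ r g g n) ⟩
      binomialSum r g n + sum≤ r (λ l → binomR r l * powS (suc l) g n)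
        ≈⟨ sum≤-binomR-suc r (λ l → powS l g n) ⟨
      binomialSum (suc r) g n ∎

  sumList-map-++ : ∀ {A : Set} (p : A → Carrier) xs ys →
    sumList (map p (xs ++ ys)) ≈ sumList (map p xs) + sumList (map p ys)
  sumList-map-++ p [] ys = sym (+-identityˡ _)
  sumList-map-++ p (x ∷ xs) ys = trans (+-cong refl (sumList-map-++ p xs ys)) (sym (+-assoc _ _ _))

  sumList-map-concat : ∀ {A : Set} (p : A → Carrier) (xss : List (List A)) →
    sumList (map p (concat xss)) ≈ sumList (map (sumList ∘ map p) xss)
  sumList-map-concat p [] = refl
  sumList-map-concat p (xs ∷ xss) =
    trans (sumList-map-++ p xs (concat xss)) (+-cong refl (sumList-map-concat p xss))

  sumList-map-cong : ∀ {A : Set} {p p′ : A → Carrier} xs → (∀ x → p x ≈ p′ x) →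
    sumList (map p xs) ≈ sumList (map p′ xs)
  sumList-map-cong [] p≈p′ = refl
  sumList-map-cong (x ∷ xs) p≈p′ = +-cong (p≈p′ x) (sumList-map-cong xs p≈p′)

  *-distribˡ-sumList : ∀ {A : Set} a (p : A → Carrier) xs →
    a * sumList (map p xs) ≈ sumList (map (λ x → a * p x) xs)
  *-distribˡ-sumList a p [] = zeroʳ a
  *-distribˡ-sumList a p (x ∷ xs) = trans (distribˡ _ _ _) (+-cong refl (*-distribˡ-sumList a p xs))

  *-distribʳ-sumList : ∀ {A : Set} a (p : A → Carrier) xs →
    sumList (map p xs) * a ≈ sumList (map (λ x → p x * a) xs)
  *-distribʳ-sumList a p [] = zeroˡ a
  *-distribʳ-sumList a p (x ∷ xs) = trans (distribʳ _ _ _) (+-cong refl (*-distribʳ-sumList a p xs))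

  sumList-map-upto : ∀ (h : ℕ → Carrier) m → sumList (map h (upto m)) ≈ sum≤ m h
  sumList-map-upto h zero = +-comm _ _
  sumList-map-upto h (suc m) = trans (+-cong refl (sumList-map-upto h m)) (+-comm _ _)

  sumComp-prodInvFact : ∀ l m → sumComp l m prodInvFact ≈ powS l eqS m
  sumComp-prodInvFact zero zero = +-identityʳ _
  sumComp-prodInvFact zero (suc m) = refl
  sumComp-prodInvFact (suc l) m = begin
      sumList (map prodInvFact (concat (map withFirst (upto m))))
        ≈⟨ sumList-map-concat prodInvFact (map withFirst (upto m)) ⟩
      sumList (map (sumList ∘ map prodInvFact) (map withFirst (upto m)))
        ≈⟨ reflexive (≡.cong sumList (≡.sym (List.map-∘ (upto m)))) ⟩
      sumList (map (λ i → sumList (map prodInvFact (withFirst i))) (upto m))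
        ≈⟨ sumList-map-cong (upto m) first-part-factors ⟩
      sumList (map (λ i → qfactInv i * powS l eqS (m ∸ i)) (upto m))
        ≈⟨ sumList-map-upto _ m ⟩
      (eqS ⊛ powS l eqS) m
        ≈⟨ coeff (⊛-comm eqS (powS l eqS)) m ⟩
      powS (suc l) eqS m ∎
    where
    withFirst : ℕ → List (Vec ℕ (suc l))
    withFirst i = map (i ∷_) (compositions l (m ∸ i))
    first-part-factors : ∀ i → sumList (map prodInvFact (withFirst i)) ≈ qfactInv i * powS l eqS (m ∸ i)
    first-part-factors i = begin
      sumList (map prodInvFact (withFirst i))
        ≈⟨ reflexive (≡.cong sumList (≡.sym (List.map-∘ (compositions l (m ∸ i))))) ⟩
      sumList (map (λ is → qfactInv i * prodInvFact is) (compositions l (m ∸ i)))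
        ≈⟨ *-distribˡ-sumList (qfactInv i) prodInvFact (compositions l (m ∸ i)) ⟨
      qfactInv i * sumComp l (m ∸ i) prodInvFact
        ≈⟨ *-cong refl (sumComp-prodInvFact l (m ∸ i)) ⟩
      qfactInv i * powS l eqS (m ∸ i) ∎

  two : Carrier
  two = 1# + 1#

  inverse-* : ∀ {a a′ b b′} → a * a′ ≈ 1# → b * b′ ≈ 1# → (a * b) * (a′ * b′) ≈ 1#
  inverse-* aa′≈1 bb′≈1 = trans (*-interchange _ _ _ _) (trans (*-cong aa′≈1 bb′≈1) (*-identityˡ 1#))

  one-⊞-eqS : one ⊞ eqS ≐ eqPlus1
  one-⊞-eqS = coeffwise λ where
    zero → refl
    (suc n) → +-identityˡ _

  eqxS-0 : eqxS 0# ≐ one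
  eqxS-0 = coeffwise λ where
    zero → *-identityˡ 1#
    (suc n) → trans (*-cong (zeroʳ _) refl) (zeroˡ _)

  B0-coefficient : ∀ r j → B0 r j ≈ qfact j * powS r bernGen j
  B0-coefficient r j = *-cong refl
    (trans (coeff (⊛-cong (Series.refl {powS r bernGen}) eqxS-0) j) (coeff (⊛-identityʳ (powS r bernGen)) j))

  eulerGen-⊛-eqPlus1 : half * two ≈ 1# → eulerGen ⊛ eqPlus1 ≐ scale two one
  eulerGen-⊛-eqPlus1 half-two = Series.trans (⊛-scaleˡ two (invS eqPlus1 half) eqPlus1) (coeffwise λ n →
    *-cong refl (trans (coeff (⊛-comm (invS eqPlus1 half) eqPlus1) n) (coeff (invS-inverseʳ eqPlus1 half half-two) n)))

  module WithInverses (inv-qint : ∀ n → inv n * qint (suc n) ≈ 1#) (half-two : half * two ≈ 1#) where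

    qfact-qfactInv : ∀ j → qfact j * qfactInv j ≈ 1#
    qfact-qfactInv zero = *-identityˡ 1#
    qfact-qfactInv (suc j) = inverse-* (qfact-qfactInv j) (trans (*-comm _ _) (inv-qint j))

    half^r-two^r : ∀ r → half ^R r * two ^R r ≈ 1#
    half^r-two^r zero = *-identityˡ 1#
    half^r-two^r (suc r) = inverse-* (half^r-two^r r) half-two

    qfact-qbinom-telescope : ∀ n k m →
      ((qfact m * qbinom (m +ℕ k) m) * qbinom n (m +ℕ k)) * qfact (n ∸ m ∸ k) ≈ qfact n * qfactInv k
    qfact-qbinom-telescope n k m = begin
        ((qfact m * qbinom (m +ℕ k) m) * qbinom n (m +ℕ k)) * qfact j
          ≈⟨ *-cong (*-cong (*-cong refl (*-cong refl (*-cong refl (reflexive (≡.cong qfactInv (ℕ.m+n∸m≡n m k))))))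
                (*-cong refl (*-cong refl (reflexive (≡.cong qfactInv (≡.sym (ℕ.∸-+-assoc n m k))))))) refl ⟩
        ((qfact m * (qfact (m +ℕ k) * (qfactInv m * qfactInv k))) * (qfact n * (qfactInv (m +ℕ k) * qfactInv j))) * qfact j
          ≈⟨ regroup _ _ _ _ _ _ _ _ ⟩
        ((qfact m * qfact (m +ℕ k)) * (qfactInv m * qfactInv (m +ℕ k))) * ((qfact j * qfactInv j) * (qfact n * qfactInv k))
          ≈⟨ *-cong (inverse-* (qfact-qfactInv m) (qfact-qfactInv (m +ℕ k))) (*-cong (qfact-qfactInv j) refl) ⟩
        1# * (1# * (qfact n * qfactInv k))
          ≈⟨ trans (*-identityˡ _) (*-identityˡ _) ⟩
        qfact n * qfactInv k ∎
      where
      j : ℕ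
      j = n ∸ m ∸ k
      open *-Solver
      regroup : ∀ a A a′ K N A′ j′ J →
        ((a * (A * (a′ * K))) * (N * (A′ * j′))) * J ≈ ((a * A) * (a′ * A′)) * ((J * j′) * (N * K))
      regroup = solve 8 (λ a A a′ K N A′ j′ J →
        ((a ⊕ (A ⊕ (a′ ⊕ K))) ⊕ (N ⊕ (A′ ⊕ j′))) ⊕ J ⊜ ((a ⊕ A) ⊕ (a′ ⊕ A′)) ⊕ ((J ⊕ j′) ⊕ (N ⊕ K))) refl

    bernoulli-euler-series : ∀ r x →
      (powS r eulerGen ⊛ eqxS x) ⊛ (powS r eqPlus1 ⊛ powS r bernGen) ≐ scale (two ^R r) (powS r bernGen ⊛ eqxS x)
    bernoulli-euler-series r x =
      Series.trans (interchange (powS r eulerGen) (eqxS x) (powS r eqPlus1) (powS r bernGen))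
        (Series.trans (⊛-cong euler^r-⊛-eqPlus1^r (⊛-comm (eqxS x) (powS r bernGen)))
          (Series.trans (⊛-scaleˡ (two ^R r) one (powS r bernGen ⊛ eqxS x))
            (coeffwise λ n → *-cong refl (coeff (⊛-identityˡ (powS r bernGen ⊛ eqxS x)) n))))
      where
      euler^r-⊛-eqPlus1^r : powS r eulerGen ⊛ powS r eqPlus1 ≐ scale (two ^R r) one
      euler^r-⊛-eqPlus1^r = Series.trans (powS-distrib-⊛ r eulerGen eqPlus1)
        (Series.trans (powS-cong r (eulerGen-⊛-eqPlus1 half-two)) (powS-scale-one r two))

    B-as-product-coefficient : ∀ r n x →
      B r n x ≈ half ^R r * (qfact n * ((powS r eulerGen ⊛ eqxS x) ⊛ (powS r eqPlus1 ⊛ powS r bernGen)) n)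
    B-as-product-coefficient r n x = sym (begin
        half ^R r * (qfact n * ((powS r eulerGen ⊛ eqxS x) ⊛ (powS r eqPlus1 ⊛ powS r bernGen)) n)
          ≈⟨ *-cong refl (*-cong refl (coeff (bernoulli-euler-series r x) n)) ⟩
        half ^R r * (qfact n * (two ^R r * (powS r bernGen ⊛ eqxS x) n))
          ≈⟨ regroup _ _ _ _ ⟩
        (half ^R r * two ^R r) * B r n x
          ≈⟨ trans (*-cong (half^r-two^r r) refl) (*-identityˡ _) ⟩
        B r n x ∎)
      where
      open *-Solver
      regroup : ∀ h N t X → h * (N * (t * X)) ≈ (h * t) * (N * X)
      regroup = solve 4 (λ h N t X → h ⊕ (N ⊕ (t ⊕ X)) ⊜ (h ⊕ t) ⊕ (N ⊕ X)) refl

    qmultinom-summand : ∀ r n k m →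
      sum≤ r (λ l → sumComp l m (λ is →
        binomR r l * qmultinom m is * qbinom (m +ℕ k) m * qbinom n (m +ℕ k) * B0 r (n ∸ m ∸ k)))
      ≈ (powS r eqPlus1 m * powS r bernGen (n ∸ k ∸ m)) * (qfact n * qfactInv k)
    qmultinom-summand r n k m = begin
        sum≤ r (λ l → sumComp l m (λ is → binomR r l * qmultinom m is * c₁ * c₂ * B0 r j))
          ≈⟨ sum<-cong (suc r) (λ l → sumList-map-cong (compositions l m) (λ is → regroup _ _ _ _ _ _)) ⟩
        sum≤ r (λ l → sumComp l m (λ is → binomR r l * prodInvFact is * W))
          ≈⟨ sum<-cong (suc r) composition-sum ⟩
        sum≤ r (λ l → binomR r l * powS l eqS m * W)
          ≈⟨ *-distribʳ-sum< (suc r) W _ ⟨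
        binomialSum r eqS m * W
          ≈⟨ *-cong (sym (coeff (Series.trans (powS-cong r (Series.sym one-⊞-eqS)) (binomial-theorem r eqS)) m)) W-telescopes ⟩
        powS r eqPlus1 m * (powS r bernGen (n ∸ k ∸ m) * (qfact n * qfactInv k))
          ≈⟨ *-assoc _ _ _ ⟨
        (powS r eqPlus1 m * powS r bernGen (n ∸ k ∸ m)) * (qfact n * qfactInv k) ∎
      where
      j : ℕ
      j = n ∸ m ∸ k
      c₁ c₂ W : Carrier
      c₁ = qbinom (m +ℕ k) m
      c₂ = qbinom n (m +ℕ k)
      W = ((qfact m * c₁) * c₂) * B0 r j
      composition-sum : ∀ l → sumComp l m (λ is → binomR r l * prodInvFact is * W) ≈ binomR r l * powS l eqS m * W
      composition-sum l = begin
        sumComp l m (λ is → binomR r l * prodInvFact is * W)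
          ≈⟨ *-distribʳ-sumList W (λ is → binomR r l * prodInvFact is) (compositions l m) ⟨
        sumComp l m (λ is → binomR r l * prodInvFact is) * W
          ≈⟨ *-cong (*-distribˡ-sumList (binomR r l) prodInvFact (compositions l m)) refl ⟨
        binomR r l * sumComp l m prodInvFact * W
          ≈⟨ *-cong (*-cong refl (sumComp-prodInvFact l m)) refl ⟩
        binomR r l * powS l eqS m * W ∎
      W-telescopes : W ≈ powS r bernGen (n ∸ k ∸ m) * (qfact n * qfactInv k)
      W-telescopes = begin
        W                                                        ≈⟨ *-cong refl (B0-coefficient r j) ⟩
        ((qfact m * c₁) * c₂) * (qfact j * powS r bernGen j)     ≈⟨ *-assoc _ _ _ ⟨
        (((qfact m * c₁) * c₂) * qfact j) * powS r bernGen j     ≈⟨ *-cong (qfact-qbinom-telescope n k m) refl ⟩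
        (qfact n * qfactInv k) * powS r bernGen j                ≈⟨ *-comm _ _ ⟩
        powS r bernGen j * (qfact n * qfactInv k)                ≈⟨ *-cong (reflexive (≡.cong (powS r bernGen) j≡n∸k∸m)) refl ⟩
        powS r bernGen (n ∸ k ∸ m) * (qfact n * qfactInv k)      ∎
        where
        j≡n∸k∸m : j ≡ n ∸ k ∸ m
        j≡n∸k∸m = ≡.trans (ℕ.∸-+-assoc n m k) (≡.trans (≡.cong (n ∸_) (ℕ.+-comm m k)) (≡.sym (ℕ.∸-+-assoc n k m)))
      open *-Solver
      regroup : ∀ b F p x₁ x₂ x₃ → (((b * (F * p)) * x₁) * x₂) * x₃ ≈ (b * p) * (((F * x₁) * x₂) * x₃)
      regroup = solve 6 (λ b F p x₁ x₂ x₃ →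
        (((b ⊕ (F ⊕ p)) ⊕ x₁) ⊕ x₂) ⊕ x₃ ⊜ (b ⊕ p) ⊕ (((F ⊕ x₁) ⊕ x₂) ⊕ x₃)) refl

    euler-summand : ∀ r n x k →
      sum≤ (n ∸ k) (λ m → sum≤ r (λ l → sumComp l m (λ is →
        binomR r l * qmultinom m is * qbinom (m +ℕ k) m * qbinom n (m +ℕ k) * B0 r (n ∸ m ∸ k))))
      * E r k x
      ≈ qfact n * ((powS r eulerGen ⊛ eqxS x) k * (powS r eqPlus1 ⊛ powS r bernGen) (n ∸ k))
    euler-summand r n x k = begin
        _ ≈⟨ *-cong (sum<-cong (suc (n ∸ k)) (qmultinom-summand r n k)) refl ⟩
        sum≤ (n ∸ k) (λ m → (powS r eqPlus1 m * powS r bernGen (n ∸ k ∸ m)) * (qfact n * qfactInv k)) * E r k x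
          ≈⟨ *-cong (*-distribʳ-sum< (suc (n ∸ k)) _ _) refl ⟨
        ((powS r eqPlus1 ⊛ powS r bernGen) (n ∸ k) * (qfact n * qfactInv k)) * (qfact k * eulerPart)
          ≈⟨ regroup _ _ _ _ _ ⟩
        (qfact n * (eulerPart * (powS r eqPlus1 ⊛ powS r bernGen) (n ∸ k))) * (qfact k * qfactInv k)
          ≈⟨ trans (*-cong refl (qfact-qfactInv k)) (*-identityʳ _) ⟩
        qfact n * (eulerPart * (powS r eqPlus1 ⊛ powS r bernGen) (n ∸ k)) ∎
      where
      eulerPart : Carrier
      eulerPart = (powS r eulerGen ⊛ eqxS x) k
      open *-Solver
      regroup : ∀ Y N I F Z → (Y * (N * I)) * (F * Z) ≈ (N * (Z * Y)) * (F * I)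
      regroup = solve 5 (λ Y N I F Z → (Y ⊕ (N ⊕ I)) ⊕ (F ⊕ Z) ⊜ (N ⊕ (Z ⊕ Y)) ⊕ (F ⊕ I)) refl

theorem9 : ∀ {c ℓ : Level} (R : CommutativeRing c ℓ)
    (q : CommutativeRing.Carrier R)
    (inv : ℕ → CommutativeRing.Carrier R)
    (half : CommutativeRing.Carrier R) →
    let open CommutativeRing R
        open QCalc R q inv half
    in (∀ n → inv n * qint (suc n) ≈ 1#) →
       (half * (1# + 1#) ≈ 1#) →
       ∀ (n r : ℕ) (x : Carrier) →
       B r n x ≈
         (half ^R r) *
         sum≤ n (λ k →
           sum≤ (n ∸ k) (λ m →
             sum≤ r (λ l →
               sumComp l m (λ is →
                 binomR r l * qmultinom m is
                 * qbinom (m +ℕ k) m * qbinom n (m +ℕ k)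
                 * B0 r (n ∸ m ∸ k))))
           * E r k x)
theorem9 R q inv half inv-qint half-two n r x =
  trans (B-as-product-coefficient r n x)
        (*-cong refl (trans (*-distribˡ-sum< (suc n) (qfact n) _)
                            (sym (sum<-cong (suc n) (euler-summand r n x)))))
  where
  open CommutativeRing R
  open QCalc R q inv half
  open QSeries R q inv half
  open QSeries.WithInverses R q inv half inv-qint half-two
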